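{- Let $n\in\mathbb{P}$ and $I,J\subseteq[n-1]$ with $I\cap J=\emptyset$. Then $$\sum_{\sigma\in\mathcal{D}^I_J(S_n)}(-1)^{\ell(\sigma)}x^{L(\sigma)}=\sum_{\sigma\in\mathcal{D}^I_J(C_n)}(-1)^{\ell(\sigma)}x^{L(\sigma)}.$$
   Context: $S_n$ is the symmetric group on $[n]=\{1,\ldots,n\}$. For $\sigma\in S_n$: $\ell(\sigma)$ = number of pairs $i<j$ with $\sigma(i)>\sigma(j)$; $L(\sigma)$ = number of such pairs with $i\not\equiv j\pmod 2$; $D(\sigma)=\{i\in[n-1]:\sigma(i)>\sigma(i+1)\}$. For disjoint $I,J\subseteq[n-1]$ and $X\subseteq S_n$, $\mathcal{D}^I_J(X)=\{\sigma\in X: J\subseteq D(\sigma)\subseteq[n-1]\setminus I\}$. $C_n=C_{n,+}\cup C_{n,- }$, where $C_{n,+}=\{w\in S_n: i+w(i)\text{ even for all } i\}$ and $C_{n,- }=\{w\in S_n: i+w(i)\text{ odd for all } i\}$. -}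

module Defs where

open import Data.Bool using (Bool; true; false; _∧_; _∨_; not; if_then_else_)
open import Data.Nat using (ℕ; zero; suc; _+_; _<ᵇ_; _≡ᵇ_)
open import Data.Nat.Properties using (_≟_)
open import Data.Fin using (Fin; toℕ; inject₁) renaming (zero to fzero; suc to fsuc)
open import Data.Fin.Subset using (Subset; _⊆_; ∁; _∩_; ⊥)
open import Data.Integer using (ℤ; +_; -_) renaming (_+_ to _+ℤ_)
open import Data.List using (List; []; _∷_; filter; map; concatMap; allFin; foldr; length)
open import Data.List.Relation.Unary.AllPairs using (AllPairs)
open import Data.Vec using (Vec; lookup; tabulate; toList) renaming ([] to []v; _∷_ to _∷v_)
open import Relation.Binary.PropositionalEquality using (_≡_; _≢_)
open import Relation.Nullary.Decidable using (does; ¬?)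

-- A permutation of [n] is
-- encoded (0-indexed) as a vector w : Vec (Fin n) n with pairwise distinct
-- entries, w(i) = lookup w i.  Position i (0-indexed) corresponds to i+1.
-- A subset of [n-1] = [m] is a Subset m; element k : Fin m stands for the
-- 1-indexed position k+1 (so descent at k+1 means w(k+1) > w(k+2) 1-indexed).

allVecs : (k n : ℕ) → List (Vec (Fin n) k)
allVecs zero    n = []v ∷ []
allVecs (suc k) n = concatMap (λ a → map (a ∷v_) (allVecs k n)) (allFin n)

distinctB : {n : ℕ} → List (Fin n) → Bool
distinctB [] = true
distinctB (a ∷ as) = foldr (λ b r → not (does (toℕ a ≟ toℕ b)) ∧ r) true as ∧ distinctB as

Sym : (n : ℕ) → List (Vec (Fin n) n)
Sym n = filter (λ w → distinctB (toList w) Data.Bool.≟ true) (allVecs n n)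
  where import Data.Bool

evenB : ℕ → Bool
evenB zero = true
evenB (suc k) = not (evenB k)

-- C_{n,+} ∪ C_{n,-} membership: i + w(i) all even, or all odd
allB : {n : ℕ} → (Fin n → Bool) → Bool
allB {n} p = foldr (λ i r → p i ∧ r) true (allFin n)

inCB : {n : ℕ} → Vec (Fin n) n → Bool
inCB w = allB (λ i → evenB (toℕ i + toℕ (lookup w i)))
       ∨ allB (λ i → not (evenB (toℕ i + toℕ (lookup w i))))

Csub : (n : ℕ) → List (Vec (Fin n) n)
Csub n = filter (λ w → inCB w Data.Bool.≟ true) (Sym n)
  where import Data.Bool

countPairs : {n : ℕ} → (Fin n → Fin n → Bool) → ℕ
countPairs {n} p = length (filter (λ ij → p (Data.Product.proj₁ ij) (Data.Product.proj₂ ij) Data.Bool.≟ true)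
  (concatMap (λ i → map (λ j → i Data.Product., j) (allFin n)) (allFin n)))
  where import Data.Product
        import Data.Bool

ell : {n : ℕ} → Vec (Fin n) n → ℕ
ell w = countPairs (λ i j → (toℕ i <ᵇ toℕ j) ∧ (toℕ (lookup w j) <ᵇ toℕ (lookup w i)))

Lstat : {n : ℕ} → Vec (Fin n) n → ℕ
Lstat w = countPairs (λ i j → (toℕ i <ᵇ toℕ j) ∧ (toℕ (lookup w j) <ᵇ toℕ (lookup w i))
                               ∧ not (evenB (toℕ i + toℕ j)))

Des : {m : ℕ} → Vec (Fin (suc m)) (suc m) → Subset m
Des w = tabulate (λ k → toℕ (lookup w (fsuc k)) <ᵇ toℕ (lookup w (inject₁ k)))

subB : {m : ℕ} → Subset m → Subset m → Bool
subB []v []v = true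
subB (a ∷v as) (b ∷v bs) = (not a ∨ b) ∧ subB as bs

DIJ : {m : ℕ} → Subset m → Subset m → List (Vec (Fin (suc m)) (suc m))
    → List (Vec (Fin (suc m)) (suc m))
DIJ I J X = filter (λ w → (subB J (Des w) ∧ subB (Des w) (∁ I)) Data.Bool.≟ true) X
  where import Data.Bool

sgn : ℕ → ℤ
sgn k = if evenB k then + 1 else - (+ 1)

-- coefficient of x^k in Σ_{w ∈ X} (-1)^{ℓ(w)} x^{L(w)}
coeff : {n : ℕ} → List (Vec (Fin n) n) → ℕ → ℤ
coeff X k = foldr (λ w r → (if L w ≡ᵇ k then sgn (ell w) else + 0) +ℤ r) (+ 0) X
  where L = Lstat

-- Lemma 3.1:  for n = m+1 and I, J ⊆ [n-1], the coefficients of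
--   Σ_{σ ∈ 𝒟^I_J(S_n)} (-1)^ℓ(σ) x^L(σ)   and   Σ_{σ ∈ 𝒟^I_J(C_n)} (-1)^ℓ(σ) x^L(σ)
-- agree.
--
-- Proof by a sign-reversing involution.  Both sides are sums over all words of
-- length n, so it suffices that the permutations w ∈ 𝒟^I_J outside C_n contribute
-- zero.  If no two neighbouring letters b, b+1 sit at positions of equal parity in
-- w, then the parity of i + w(i) is constant, i.e. w ∈ C_n (noCoParity⇒inC).
-- Otherwise let a be the least such letter (the pivot) and swap the letters a and
-- a+1 (module Swap).  Their positions have equal parity, hence are not adjacent:
-- the descent set is unchanged; the only pair of positions whose inversion status
-- changes has even sum, so L is unchanged while ℓ changes by one; no position
-- parity changes, so the pivot is unchanged; and the new word is again outside
-- C_n.  Relabelling all words by the transposition (a a+1) permutes them, so the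
-- contributions with pivot a cancel (ΣL-allVecs-involution).

module Submission where

open import Defs
open import Data.Nat using (ℕ; suc)
open import Data.Fin.Subset using (Subset; _∩_; ⊥; ∁)
open import Relation.Binary.PropositionalEquality using (_≡_)

open import Data.Nat using (zero; _+_; _<ᵇ_; _≡ᵇ_; _<_)
import Data.Nat.Properties as ℕP
open import Data.Bool using (Bool; true; false; _∧_; _∨_; not; _xor_; if_then_else_; T)
import Data.Bool as Bool
import Data.Bool.Properties as BoolP
open import Data.Fin using (Fin; toℕ; inject₁; punchIn; punchOut) renaming (zero to fzero; suc to fsuc)
import Data.Fin.Properties as FinP
open import Data.Fin.Permutation as Perm using (Permutation; _⟨$⟩ʳ_)
open import Data.Integer using (ℤ; +_; -_; -[1+_]) renaming (_+_ to _+ℤ_)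
import Data.Integer.Properties as ℤP
open import Data.List using (List; []; _∷_; _++_; filter; map; concatMap; foldr; length; tabulate)
import Data.List.Properties as ListP
open import Data.Vec using (Vec; lookup; toList) renaming ([] to []v; _∷_ to _∷v_)
import Data.Vec as Vec
import Data.Vec.Properties as VecP
open import Data.Product using (∃; _×_; _,_; proj₁; proj₂)
open import Data.Sum using (_⊎_; inj₁; inj₂)
open import Function using (_∘_; id)
open import Function.Bundles using (module Equivalence)
open import Function.Definitions using (Injective)
open import Relation.Binary.PropositionalEquality using (refl; sym; trans; cong; cong₂; subst; _≢_; module ≡-Reasoning)
open import Relation.Nullary using (¬_; yes; no; does; contradiction)
open import Relation.Nullary.Decidable using (dec-true; dec-false)
open import Relation.Binary.Definitions using (tri<; tri≈; tri>)

import Algebra.Properties.CommutativeMonoid.Sum as FinSum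
import Algebra.Properties.CommutativeSemigroup
module ℤΣ = FinSum ℤP.+-0-commutativeMonoid
module ℕΣ = FinSum ℕP.+-0-commutativeMonoid
open ℤΣ using (sum-syntax)
module ℤ+ = Algebra.Properties.CommutativeSemigroup ℤP.+-commutativeSemigroup

_⊙_ : Bool → ℤ → ℤ
b ⊙ z = if b then z else + 0
infixr 7 _⊙_

evenB-+ : ∀ m n → evenB (m + n) ≡ not (evenB m) xor evenB n
evenB-+ zero    n = refl
evenB-+ (suc m) n = trans (cong not (evenB-+ m n)) (BoolP.not-distribˡ-xor (not (evenB m)) (evenB n))

b≢not-b : ∀ {b} → b ≢ not b
b≢not-b {true}  ()
b≢not-b {false} ()

xnor-true : ∀ {x y} → not (x xor y) ≡ true → x ≡ y
xnor-true {true}  {true}  _ = refl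
xnor-true {false} {false} _ = refl

xnor-false : ∀ {x y} → not (x xor y) ≡ false → y ≡ not x
xnor-false {true}  {false} _ = refl
xnor-false {false} {true}  _ = refl

self-neg : ∀ (z : ℤ) → z ≡ - z → z ≡ + 0
self-neg (+ zero)  _ = refl
self-neg (+ suc n) ()
self-neg -[1+ n ]  ()

even-sum : ∀ m n → evenB m ≡ evenB n → evenB (m + n) ≡ true
even-sum m n e = trans (evenB-+ m n) (trans (cong (λ x → not x xor evenB n) e) (BoolP.xor-inverseˡ (evenB n)))

∧-differs : ∀ c {x y} → c ∧ x ≢ c ∧ y → c ≡ true
∧-differs true  _  = refl
∧-differs false ne = contradiction refl ne

sgn-flip : ∀ p q → evenB p ≡ not (evenB q) → sgn p ≡ - sgn q
sgn-flip p q e with evenB p | evenB q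
sgn-flip p q refl | .false | true  = refl
sgn-flip p q refl | .true  | false = refl

⊙-∧ : ∀ x y z → (x ∧ y) ⊙ z ≡ x ⊙ y ⊙ z
⊙-∧ true  y z = refl
⊙-∧ false y z = refl

⊙-split : ∀ d c D z → d ⊙ D ⊙ z ≡ d ⊙ c ⊙ D ⊙ z +ℤ (d ∧ (not c ∧ D)) ⊙ z
⊙-split false c     D z = refl
⊙-split true  true  D z = sym (ℤP.+-identityʳ _)
⊙-split true  false D z = sym (ℤP.+-identityˡ _)

<⇒<ᵇ-true : ∀ {m n} → m < n → (m <ᵇ n) ≡ true
<⇒<ᵇ-true m<n = Equivalence.to BoolP.T-≡ (ℕP.<⇒<ᵇ m<n)

≮⇒<ᵇ-false : ∀ {m n} → ¬ m < n → (m <ᵇ n) ≡ false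
≮⇒<ᵇ-false {m} {n} m≮n with m <ᵇ n in m<ᵇn
... | false = refl
... | true  = contradiction (ℕP.<ᵇ⇒< m n (Equivalence.from BoolP.T-≡ m<ᵇn)) m≮n

<ᵇ-sucʳ : ∀ u α → u ≢ α → (u <ᵇ suc α) ≡ (u <ᵇ α)
<ᵇ-sucʳ zero    zero    u≢α = contradiction refl u≢α
<ᵇ-sucʳ zero    (suc α) u≢α = refl
<ᵇ-sucʳ (suc u) zero    u≢α = refl
<ᵇ-sucʳ (suc u) (suc α) u≢α = <ᵇ-sucʳ u α (u≢α ∘ cong suc)

<ᵇ-sucˡ : ∀ u α → u ≢ suc α → (suc α <ᵇ u) ≡ (α <ᵇ u)
<ᵇ-sucˡ zero    α u≢sα = refl
<ᵇ-sucˡ (suc u) α u≢sα = sym (<ᵇ-sucʳ α u (u≢sα ∘ cong suc ∘ sym))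

ΣL : ∀ {A : Set} → List A → (A → ℤ) → ℤ
ΣL X f = foldr (λ x r → f x +ℤ r) (+ 0) X

ΣL-cong : ∀ {A : Set} (X : List A) {f g : A → ℤ} → (∀ x → f x ≡ g x) → ΣL X f ≡ ΣL X g
ΣL-cong []      e = refl
ΣL-cong (x ∷ X) e = cong₂ _+ℤ_ (e x) (ΣL-cong X e)

ΣL-filter : ∀ {A : Set} (b : A → Bool) (X : List A) (f : A → ℤ) →
  ΣL (filter (λ x → b x Bool.≟ true) X) f ≡ ΣL X (λ x → b x ⊙ f x)
ΣL-filter b []      f = refl
ΣL-filter b (x ∷ X) f with b x
... | true  = cong (f x +ℤ_) (ΣL-filter b X f)
... | false = trans (ΣL-filter b X f) (sym (ℤP.+-identityˡ _))

ΣL-++ : ∀ {A : Set} (X Y : List A) (f : A → ℤ) → ΣL (X ++ Y) f ≡ ΣL X f +ℤ ΣL Y f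
ΣL-++ []      Y f = sym (ℤP.+-identityˡ _)
ΣL-++ (x ∷ X) Y f = trans (cong (f x +ℤ_) (ΣL-++ X Y f)) (sym (ℤP.+-assoc (f x) _ _))

ΣL-map : ∀ {A C : Set} (g : A → C) (X : List A) (f : C → ℤ) → ΣL (map g X) f ≡ ΣL X (f ∘ g)
ΣL-map g []      f = refl
ΣL-map g (x ∷ X) f = cong (f (g x) +ℤ_) (ΣL-map g X f)

ΣL-+ : ∀ {A : Set} (X : List A) (f g : A → ℤ) → ΣL X (λ x → f x +ℤ g x) ≡ ΣL X f +ℤ ΣL X g
ΣL-+ []      f g = refl
ΣL-+ (x ∷ X) f g =
  trans (cong ((f x +ℤ g x) +ℤ_) (ΣL-+ X f g)) (ℤ+.interchange (f x) (g x) (ΣL X f) (ΣL X g))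

ΣL-neg : ∀ {A : Set} (X : List A) (f : A → ℤ) → ΣL X (λ x → - f x) ≡ - ΣL X f
ΣL-neg []      f = refl
ΣL-neg (x ∷ X) f = trans (cong ((- f x) +ℤ_) (ΣL-neg X f)) (sym (ℤP.neg-distrib-+ (f x) (ΣL X f)))

ΣL-∑ : ∀ {A : Set} (X : List A) n (F : Fin n → A → ℤ) →
  ΣL X (λ x → ∑[ a < n ] F a x) ≡ ∑[ a < n ] ΣL X (F a)
ΣL-∑ []      n F = sym (ℤΣ.sum-replicate-zero n)
ΣL-∑ (x ∷ X) n F =
  trans (cong (∑[ a < n ] F a x +ℤ_) (ΣL-∑ X n F)) (sym (ℤΣ.∑-distrib-+ (λ a → F a x) (λ a → ΣL X (F a))))

ΣL-concatMap-tabulate : ∀ {A C : Set} n (g : Fin n → A) (f : A → List C) (F : C → ℤ) →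
  ΣL (concatMap f (tabulate g)) F ≡ ∑[ i < n ] ΣL (f (g i)) F
ΣL-concatMap-tabulate zero    g f F = refl
ΣL-concatMap-tabulate (suc n) g f F =
  trans (ΣL-++ (f (g fzero)) _ F) (cong (ΣL (f (g fzero)) F +ℤ_) (ΣL-concatMap-tabulate n (g ∘ fsuc) f F))

ΣL-allVecs-suc : ∀ k n (f : Vec (Fin n) (suc k) → ℤ) →
  ΣL (allVecs (suc k) n) f ≡ ∑[ x < n ] ΣL (allVecs k n) (λ v → f (x ∷v v))
ΣL-allVecs-suc k n f = trans (ΣL-concatMap-tabulate n id (λ x → map (x ∷v_) (allVecs k n)) f)
  (ℤΣ.sum-cong-≗ (λ x → ΣL-map (x ∷v_) (allVecs k n) f))

ΣL-allVecs-permute : ∀ k n (π : Permutation n n) (f : Vec (Fin n) k → ℤ) →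
  ΣL (allVecs k n) (λ w → f (Vec.map (π ⟨$⟩ʳ_) w)) ≡ ΣL (allVecs k n) f
ΣL-allVecs-permute zero    n π f = refl
ΣL-allVecs-permute (suc k) n π f = begin
  ΣL (allVecs (suc k) n) (λ w → f (Vec.map (π ⟨$⟩ʳ_) w))
    ≡⟨ ΣL-allVecs-suc k n (λ w → f (Vec.map (π ⟨$⟩ʳ_) w)) ⟩
  ∑[ x < n ] ΣL (allVecs k n) (λ v → f ((π ⟨$⟩ʳ x) ∷v Vec.map (π ⟨$⟩ʳ_) v))
    ≡⟨ ℤΣ.sum-cong-≗ (λ x → ΣL-allVecs-permute k n π (λ v → f ((π ⟨$⟩ʳ x) ∷v v))) ⟩
  ∑[ x < n ] ΣL (allVecs k n) (λ v → f ((π ⟨$⟩ʳ x) ∷v v))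
    ≡⟨ sym (ℤΣ.sum-permute (λ x → ΣL (allVecs k n) (λ v → f (x ∷v v))) π) ⟩
  ∑[ x < n ] ΣL (allVecs k n) (λ v → f (x ∷v v))
    ≡⟨ sym (ΣL-allVecs-suc k n f) ⟩
  ΣL (allVecs (suc k) n) f ∎
  where open ≡-Reasoning

ΣL-allVecs-involution : ∀ k n (π : Permutation n n) → (∀ x → π ⟨$⟩ʳ (π ⟨$⟩ʳ x) ≡ x) →
  (S : Vec (Fin n) k → Bool) (h : Vec (Fin n) k → ℤ) →
  (∀ w → S w ≡ true → S (Vec.map (π ⟨$⟩ʳ_) w) ≡ true × h (Vec.map (π ⟨$⟩ʳ_) w) ≡ - h w) →
  ΣL (allVecs k n) (λ w → S w ⊙ h w) ≡ + 0
ΣL-allVecs-involution k n π invol S h reverse = self-neg _ (begin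
  ΣL (allVecs k n) F                ≡⟨ sym (ΣL-allVecs-permute k n π F) ⟩
  ΣL (allVecs k n) (F ∘ relabel)    ≡⟨ ΣL-cong (allVecs k n) anti ⟩
  ΣL (allVecs k n) (λ w → - F w)    ≡⟨ ΣL-neg (allVecs k n) F ⟩
  - ΣL (allVecs k n) F              ∎)
  where
  open ≡-Reasoning
  relabel : Vec (Fin n) k → Vec (Fin n) k
  relabel = Vec.map (π ⟨$⟩ʳ_)
  F : Vec (Fin n) k → ℤ
  F w = S w ⊙ h w
  relabel-invol : ∀ w → relabel (relabel w) ≡ w
  relabel-invol w = trans (sym (VecP.map-∘ _ _ w)) (trans (VecP.map-cong invol w) (VecP.map-id w))
  anti : ∀ w → F (relabel w) ≡ - F w
  anti w with S w in Sw
  ... | true = trans (cong (_⊙ h (relabel w)) (proj₁ (reverse w Sw))) (proj₂ (reverse w Sw))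
  ... | false with S (relabel w) in Srw
  ...   | false = refl
  ...   | true  = contradiction (trans (sym (cong S (relabel-invol w))) (proj₁ (reverse (relabel w) Srw)))
                    (λ e → b≢not-b (trans (sym e) Sw))

count : ∀ {A : Set} → (A → Bool) → List A → ℕ
count q X = length (filter (λ x → q x Bool.≟ true) X)

bit : Bool → ℕ
bit true  = 1
bit false = 0

count-++ : ∀ {A : Set} (q : A → Bool) (X Y : List A) → count q (X ++ Y) ≡ count q X + count q Y
count-++ q X Y = trans (cong length (ListP.filter-++ (λ x → q x Bool.≟ true) X Y)) (ListP.length-++ (filter _ X))

count-tabulate : ∀ {A : Set} n (g : Fin n → A) (q : A → Bool) →
  count q (tabulate g) ≡ ℕΣ.sum (λ i → bit (q (g i)))
count-tabulate zero    g q = refl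
count-tabulate (suc n) g q with q (g fzero)
... | true  = cong suc (count-tabulate n (g ∘ fsuc) q)
... | false = count-tabulate n (g ∘ fsuc) q

count-concatMap-tabulate : ∀ {A C : Set} n (g : Fin n → A) (f : A → List C) (q : C → Bool) →
  count q (concatMap f (tabulate g)) ≡ ℕΣ.sum (λ i → count q (f (g i)))
count-concatMap-tabulate zero    g f q = refl
count-concatMap-tabulate (suc n) g f q =
  trans (count-++ q (f (g fzero)) _) (cong (λ r → count q (f (g fzero)) + r) (count-concatMap-tabulate n (g ∘ fsuc) f q))

countPairs-sum : ∀ {n} (p : Fin n → Fin n → Bool) →
  countPairs p ≡ ℕΣ.sum (λ i → ℕΣ.sum (λ j → bit (p i j)))
countPairs-sum {n} p = trans (count-concatMap-tabulate n id (λ i → map (i ,_) (tabulate id)) q)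
  (ℕΣ.sum-cong-≗ (λ i → trans (cong (count q) (ListP.map-tabulate id (i ,_))) (count-tabulate n (i ,_) q)))
  where
  q : Fin n × Fin n → Bool
  q (i , j) = p i j

countPairs-cong : ∀ {n} (p q : Fin n → Fin n → Bool) → (∀ i j → p i j ≡ q i j) → countPairs p ≡ countPairs q
countPairs-cong p q e = trans (countPairs-sum p)
  (trans (ℕΣ.sum-cong-≗ (λ i → ℕΣ.sum-cong-≗ (λ j → cong bit (e i j)))) (sym (countPairs-sum q)))

sum-bump : ∀ {n} (f g : Fin (suc n) → ℕ) (x : Fin (suc n)) →
  (∀ j → j ≢ x → f j ≡ g j) → f x ≡ suc (g x) → ℕΣ.sum f ≡ suc (ℕΣ.sum g)
sum-bump f g x agree fx = begin
  ℕΣ.sum f                                            ≡⟨ ℕΣ.sum-remove {i = x} f ⟩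
  f x + ℕΣ.sum (λ j → f (punchIn x j))        ≡⟨ cong₂ _+_ fx (ℕΣ.sum-cong-≗ off-x) ⟩
  suc (g x + ℕΣ.sum (λ j → g (punchIn x j)))  ≡⟨ cong suc (sym (ℕΣ.sum-remove {i = x} g)) ⟩
  suc (ℕΣ.sum g)                                      ∎
  where
  open ≡-Reasoning
  off-x : ∀ j → f (punchIn x j) ≡ g (punchIn x j)
  off-x j = agree _ (FinP.punchInᵢ≢i x j)

countPairs-bump : ∀ {n} (p q : Fin (suc n) → Fin (suc n) → Bool) (x₁ x₂ : Fin (suc n)) →
  (∀ i j → ¬ (i ≡ x₁ × j ≡ x₂) → p i j ≡ q i j) → p x₁ x₂ ≡ true → q x₁ x₂ ≡ false →
  countPairs p ≡ suc (countPairs q)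
countPairs-bump p q x₁ x₂ agree px qx = trans (countPairs-sum p) (trans
  (sum-bump (row p) (row q) x₁ other-rows
    (sum-bump (λ j → bit (p x₁ j)) (λ j → bit (q x₁ j)) x₂
      (λ j j≢x₂ → cong bit (agree x₁ j (j≢x₂ ∘ proj₂))) (trans (cong bit px) (sym (cong (suc ∘ bit) qx)))))
  (cong suc (sym (countPairs-sum q))))
  where
  row : (Fin _ → Fin _ → Bool) → Fin _ → ℕ
  row r i = ℕΣ.sum (λ j → bit (r i j))
  other-rows : ∀ i → i ≢ x₁ → row p i ≡ row q i
  other-rows i i≢x₁ = ℕΣ.sum-cong-≗ (λ j → cong bit (agree i j (i≢x₁ ∘ proj₁)))

first : ∀ {m} → (Fin m → Bool) → Fin m → Bool
first s fzero    = s fzero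
first s (fsuc a) = not (s fzero) ∧ first (s ∘ fsuc) a

anyF : ∀ {m} → (Fin m → Bool) → Bool
anyF {zero}  s = false
anyF {suc m} s = s fzero ∨ anyF (s ∘ fsuc)

-- Splitting by the least witness: at most one index is "first".
∑-first : ∀ {m} (s : Fin m → Bool) (z : ℤ) → ∑[ a < m ] (first s a ⊙ z) ≡ anyF s ⊙ z
∑-first {zero}  s z = refl
∑-first {suc m} s z with s fzero
... | true  = trans (cong (z +ℤ_) (ℤΣ.sum-replicate-zero m)) (ℤP.+-identityʳ z)
... | false = trans (ℤP.+-identityˡ _) (∑-first (s ∘ fsuc) z)

first⇒ : ∀ {m} (s : Fin m → Bool) a → first s a ≡ true → s a ≡ true
first⇒ s fzero    h = h
first⇒ s (fsuc a) h = first⇒ (s ∘ fsuc) a (BoolP.∧-conicalʳ (not (s fzero)) _ h)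

anyF-false : ∀ {m} (s : Fin m → Bool) → anyF s ≡ false → ∀ b → s b ≡ false
anyF-false {suc m} s h fzero    = BoolP.∨-conicalˡ (s fzero) _ h
anyF-false {suc m} s h (fsuc b) = anyF-false (s ∘ fsuc) (BoolP.∨-conicalʳ (s fzero) _ h) b

first-cong : ∀ {m} {s s' : Fin m → Bool} → (∀ b → s b ≡ s' b) → ∀ a → first s a ≡ first s' a
first-cong e fzero    = e fzero
first-cong e (fsuc a) = cong₂ (λ x y → not x ∧ y) (e fzero) (first-cong (e ∘ fsuc) a)

posOf : ∀ {n k} → Vec (Fin n) k → Fin n → ℕ
posOf []v       v = 0
posOf (x ∷v w) v = if does (x FinP.≟ v) then 0 else suc (posOf w v)

posOf-lookup : ∀ {n k} (w : Vec (Fin n) k) → Injective _≡_ _≡_ (lookup w) →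
  ∀ i → posOf w (lookup w i) ≡ toℕ i
posOf-lookup (x ∷v w) inj fzero rewrite dec-true (x FinP.≟ x) refl = refl
posOf-lookup (x ∷v w) inj (fsuc i) rewrite dec-false (x FinP.≟ lookup w i) (FinP.0≢1+n ∘ inj) =
  cong suc (posOf-lookup w (FinP.suc-injective ∘ inj) i)

posOf-map : ∀ {n k} (t : Fin n → Fin n) → (∀ x → t (t x) ≡ x) →
  ∀ (w : Vec (Fin n) k) v → posOf (Vec.map t w) v ≡ posOf w (t v)
posOf-map t invol []v       v = refl
posOf-map t invol (x ∷v w) v =
  cong₂ (λ b r → if b then 0 else suc r) same-test (posOf-map t invol w v)
  where
  same-test : does (t x FinP.≟ v) ≡ does (x FinP.≟ t v)
  same-test with t x FinP.≟ v | x FinP.≟ t v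
  ... | yes _  | yes _  = refl
  ... | no  _  | no  _  = refl
  ... | yes tx≡v | no x≢tv = contradiction (trans (sym (invol x)) (cong t tx≡v)) x≢tv
  ... | no tx≢v  | yes x≡tv = contradiction (trans (cong t x≡tv) (invol v)) tx≢v

fresh : ∀ {n} → Fin n → List (Fin n) → Bool
fresh x u = foldr (λ b r → not (toℕ x ≡ᵇ toℕ b) ∧ r) true u

fresh⇒≢ : ∀ {n k} (x : Fin n) (w : Vec (Fin n) k) → fresh x (toList w) ≡ true → ∀ j → x ≢ lookup w j
fresh⇒≢ x (y ∷v w) h j x≡wj with toℕ x ≡ᵇ toℕ y in x≟y
fresh⇒≢ x (y ∷v w) () j x≡wj | true
fresh⇒≢ x (y ∷v w) h fzero    x≡y  | false = subst T x≟y (ℕP.≡⇒≡ᵇ _ _ (cong toℕ x≡y))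
fresh⇒≢ x (y ∷v w) h (fsuc j) x≡wj | false = fresh⇒≢ x w h j x≡wj

≡ᵇ-cong : ∀ {a b c d} → (a ≡ b → c ≡ d) → (c ≡ d → a ≡ b) → (a ≡ᵇ b) ≡ (c ≡ᵇ d)
≡ᵇ-cong {a} {b} {c} {d} ⇒ ⇐ with a ≡ᵇ b in a≟b | c ≡ᵇ d in c≟d
... | true  | true  = refl
... | false | false = refl
... | true  | false = contradiction (ℕP.≡⇒≡ᵇ c d (⇒ (ℕP.≡ᵇ⇒≡ a b (subst T (sym a≟b) _)))) (subst T c≟d)
... | false | true  = contradiction (ℕP.≡⇒≡ᵇ a b (⇐ (ℕP.≡ᵇ⇒≡ c d (subst T (sym c≟d) _)))) (subst T a≟b)

distinct⇒injective : ∀ {n k} (w : Vec (Fin n) k) → distinctB (toList w) ≡ true → Injective _≡_ _≡_ (lookup w)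
distinct⇒injective (x ∷v w) h {fzero}  {fzero}  e = refl
distinct⇒injective (x ∷v w) h {fzero}  {fsuc j} e = contradiction e (fresh⇒≢ x w (BoolP.∧-conicalˡ _ _ h) j)
distinct⇒injective (x ∷v w) h {fsuc i} {fzero}  e = contradiction (sym e) (fresh⇒≢ x w (BoolP.∧-conicalˡ _ _ h) i)
distinct⇒injective (x ∷v w) h {fsuc i} {fsuc j} e =
  cong fsuc (distinct⇒injective w (BoolP.∧-conicalʳ (fresh x (toList w)) _ h) e)

distinctB-map : ∀ {n k} (t : Fin n → Fin n) → Injective _≡_ _≡_ t → (w : Vec (Fin n) k) →
  distinctB (toList (Vec.map t w)) ≡ distinctB (toList w)
distinctB-map t t-inj []v       = refl
distinctB-map t t-inj (x ∷v w) = cong₂ _∧_ (fresh-map w) (distinctB-map t t-inj w)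
  where
  same-test : ∀ y → (toℕ (t x) ≡ᵇ toℕ (t y)) ≡ (toℕ x ≡ᵇ toℕ y)
  same-test y = ≡ᵇ-cong (λ e → cong toℕ (t-inj (FinP.toℕ-injective e))) (λ e → cong (toℕ ∘ t) (FinP.toℕ-injective e))
  fresh-map : ∀ {k} (u : Vec (Fin _) k) → fresh (t x) (toList (Vec.map t u)) ≡ fresh x (toList u)
  fresh-map []v       = refl
  fresh-map (y ∷v u) = cong₂ _∧_ (cong not (same-test y)) (fresh-map u)

injective⇒surjective : ∀ {n} {f : Fin n → Fin n} → Injective _≡_ _≡_ f → ∀ v → ∃ λ i → f i ≡ v
injective⇒surjective {suc m} {f} inj v with FinP.any? (λ i → f i FinP.≟ v)
... | yes hit = hit
... | no miss = contradiction (FinP.injective⇒≤ punched-inj) ℕP.1+n≰n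
  where
  avoids : ∀ i → v ≢ f i
  avoids i e = miss (i , sym e)
  punched-inj : Injective _≡_ _≡_ (λ i → punchOut (avoids i))
  punched-inj e = inj (FinP.punchOut-injective (avoids _) (avoids _) e)

allB-intro : ∀ {n} (p : Fin n → Bool) → (∀ i → p i ≡ true) → allB p ≡ true
allB-intro {n} p = go n id
  where
  go : ∀ k (g : Fin k → Fin n) → (∀ i → p i ≡ true) → foldr (λ i r → p i ∧ r) true (tabulate g) ≡ true
  go zero    g h = refl
  go (suc k) g h rewrite h (g fzero) = go k (g ∘ fsuc) h

allB-elim : ∀ {n} (p : Fin n → Bool) → allB p ≡ true → ∀ i → p i ≡ true
allB-elim {n} p = go n id
  where
  go : ∀ k (g : Fin k → Fin n) → foldr (λ i r → p i ∧ r) true (tabulate g) ≡ true → ∀ i → p (g i) ≡ true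
  go (suc k) g h fzero    = BoolP.∧-conicalˡ _ _ h
  go (suc k) g h (fsuc i) = go k (g ∘ fsuc) (BoolP.∧-conicalʳ (p (g fzero)) _ h) i

inCB-false : ∀ {n} (w : Vec (Fin n) n) i j →
  evenB (toℕ j + toℕ (lookup w j)) ≡ not (evenB (toℕ i + toℕ (lookup w i))) → inCB w ≡ false
inCB-false w i j differ
  with allB (λ x → evenB (toℕ x + toℕ (lookup w x))) in all-even
     | allB (λ x → not (evenB (toℕ x + toℕ (lookup w x)))) in all-odd
... | false | false = refl
... | true  | _     = contradiction
  (trans (sym (allB-elim _ all-even j)) (trans differ (cong not (allB-elim _ all-even i)))) λ ()
... | false | true  = contradiction
  (trans (sym (allB-elim _ all-odd j)) (cong not (trans differ (allB-elim _ all-odd i)))) λ ()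

constant-parity⇒inC : ∀ {n} (w : Vec (Fin n) n) b → (∀ i → evenB (toℕ i + toℕ (lookup w i)) ≡ b) → inCB w ≡ true
constant-parity⇒inC w true  const = cong (_∨ allB (not ∘ parity)) (allB-intro parity const)
  where parity = λ i → evenB (toℕ i + toℕ (lookup w i))
constant-parity⇒inC w false const =
  trans (cong (allB parity ∨_) (allB-intro (not ∘ parity) (λ i → cong not (const i)))) (BoolP.∨-zeroʳ (allB parity))
  where parity = λ i → evenB (toℕ i + toℕ (lookup w i))

posParity : ∀ {n k} → Vec (Fin n) k → Fin n → Bool
posParity w v = evenB (posOf w v)

coParity : ∀ {m k} → Vec (Fin (suc m)) k → Fin m → Bool
coParity w b = not (posParity w (inject₁ b) xor posParity w (fsuc b))

neighbours-constant : ∀ {m} {X : Set} (c : Fin (suc m) → X) →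
  (∀ b → c (inject₁ b) ≡ c (fsuc b)) → ∀ v → c v ≡ c fzero
neighbours-constant         c step fzero    = refl
neighbours-constant {suc m} c step (fsuc b) =
  trans (sym (step b)) (neighbours-constant (c ∘ inject₁) (step ∘ inject₁) b)

noCoParity⇒inC : ∀ {m} (w : Vec (Fin (suc m)) (suc m)) → Injective _≡_ _≡_ (lookup w) →
  anyF (coParity w) ≡ false → inCB w ≡ true
noCoParity⇒inC {m} w inj none = constant-parity⇒inC w (c fzero) parity-via-c
  where
  c : Fin (suc m) → Bool
  c v = evenB (posOf w v + toℕ v)
  step : ∀ b → c (inject₁ b) ≡ c (fsuc b)
  step b = begin
    evenB (posOf w (inject₁ b) + toℕ (inject₁ b))   ≡⟨ evenB-+ (posOf w (inject₁ b)) _ ⟩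
    not eA xor evenB (toℕ (inject₁ b))              ≡⟨ cong (λ n → not eA xor evenB n) (FinP.toℕ-inject₁ b) ⟩
    not eA xor evenB (toℕ b)                        ≡⟨ sym (BoolP.not-distribˡ-xor eA _) ⟩
    not (eA xor evenB (toℕ b))                      ≡⟨ BoolP.not-distribʳ-xor eA _ ⟩
    eA xor not (evenB (toℕ b))                      ≡⟨ cong (_xor not (evenB (toℕ b))) (sym (BoolP.not-involutive eA)) ⟩
    not (not eA) xor not (evenB (toℕ b))            ≡⟨ cong (λ x → not x xor not (evenB (toℕ b))) (sym eB≡not-eA) ⟩
    not eB xor evenB (suc (toℕ b))                  ≡⟨ sym (evenB-+ (posOf w (fsuc b)) _) ⟩
    evenB (posOf w (fsuc b) + toℕ (fsuc b))         ∎
    where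
    open ≡-Reasoning
    eA eB : Bool
    eA = posParity w (inject₁ b)
    eB = posParity w (fsuc b)
    eB≡not-eA : eB ≡ not eA
    eB≡not-eA = xnor-false (anyF-false (coParity w) none b)
  parity-via-c : ∀ i → evenB (toℕ i + toℕ (lookup w i)) ≡ c fzero
  parity-via-c i = trans (cong (λ p → evenB (p + toℕ (lookup w i))) (sym (posOf-lookup w inj i)))
                         (neighbours-constant c step (lookup w i))

module Adjacent {m : ℕ} (a : Fin m) where
  A B : Fin (suc m)
  A = inject₁ a
  B = fsuc a

  toℕ-A : toℕ A ≡ toℕ a
  toℕ-A = FinP.toℕ-inject₁ a

  A≢B : A ≢ B
  A≢B e = ℕP.1+n≢n (sym (trans (sym toℕ-A) (cong toℕ e)))

  π : Permutation (suc m) (suc m)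
  π = Perm.transpose A B

  τ : Fin (suc m) → Fin (suc m)
  τ x = π ⟨$⟩ʳ x

  τ-A : τ A ≡ B
  τ-A rewrite dec-true (A FinP.≟ A) refl = refl

  τ-B : τ B ≡ A
  τ-B rewrite dec-false (B FinP.≟ A) (A≢B ∘ sym) | dec-true (B FinP.≟ B) refl = refl

  τ-other : ∀ {x} → x ≢ A → x ≢ B → τ x ≡ x
  τ-other {x} x≢A x≢B rewrite dec-false (x FinP.≟ A) x≢A | dec-false (x FinP.≟ B) x≢B = refl

  data Case (x : Fin (suc m)) : Set where
    is-A  : x ≡ A → Case x
    is-B  : x ≡ B → Case x
    other : x ≢ A → x ≢ B → Case x

  case : ∀ x → Case x
  case x with x FinP.≟ A | x FinP.≟ B
  ... | yes x≡A | _       = is-A x≡A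
  ... | no  _   | yes x≡B = is-B x≡B
  ... | no x≢A  | no x≢B  = other x≢A x≢B

  pair-case : ∀ x y → (x ≡ A × y ≡ B) ⊎ (x ≡ B × y ≡ A) ⊎ (¬ (x ≡ A × y ≡ B) × ¬ (x ≡ B × y ≡ A))
  pair-case x y with case x | case y
  ... | is-A x≡A | is-B y≡B = inj₁ (x≡A , y≡B)
  ... | is-B x≡B | is-A y≡A = inj₂ (inj₁ (x≡B , y≡A))
  ... | is-A x≡A | is-A y≡A = inj₂ (inj₂ ((λ (_ , y≡B) → A≢B (trans (sym y≡A) y≡B)) , (λ (x≡B , _) → A≢B (trans (sym x≡A) x≡B))))
  ... | is-B x≡B | is-B y≡B = inj₂ (inj₂ ((λ (x≡A , _) → A≢B (trans (sym x≡A) x≡B)) , (λ (_ , y≡A) → A≢B (trans (sym y≡A) y≡B))))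
  ... | is-A x≡A | other y≢A y≢B = inj₂ (inj₂ ((y≢B ∘ proj₂) , (y≢A ∘ proj₂)))
  ... | is-B x≡B | other y≢A y≢B = inj₂ (inj₂ ((y≢B ∘ proj₂) , (y≢A ∘ proj₂)))
  ... | other x≢A x≢B | _ = inj₂ (inj₂ ((x≢A ∘ proj₁) , (x≢B ∘ proj₁)))

  τ-involutive : ∀ x → τ (τ x) ≡ x
  τ-involutive x with case x
  ... | is-A refl = trans (cong τ τ-A) τ-B
  ... | is-B refl = trans (cong τ τ-B) τ-A
  ... | other x≢A x≢B = trans (cong τ (τ-other x≢A x≢B)) (τ-other x≢A x≢B)

  τ-injective : Injective _≡_ _≡_ τ
  τ-injective {x} {y} e = trans (sym (τ-involutive x)) (trans (cong τ e) (τ-involutive y))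

  A<B : (toℕ A <ᵇ toℕ B) ≡ true
  A<B rewrite toℕ-A = <⇒<ᵇ-true (ℕP.n<1+n (toℕ a))

  B≮A : (toℕ B <ᵇ toℕ A) ≡ false
  B≮A rewrite toℕ-A = ≮⇒<ᵇ-false (ℕP.≤⇒≯ (ℕP.n≤1+n (toℕ a)))

  both-irrefl : ∀ v → (toℕ (τ v) <ᵇ toℕ (τ v)) ≡ (toℕ v <ᵇ toℕ v)
  both-irrefl v = trans (≮⇒<ᵇ-false (ℕP.n≮n (toℕ (τ v)))) (sym (≮⇒<ᵇ-false (ℕP.n≮n (toℕ v))))

  toℕ-to-A : ∀ {y} → toℕ y ≡ toℕ a → y ≡ A
  toℕ-to-A e = FinP.toℕ-injective (trans e (sym toℕ-A))

  τ-monotone : ∀ x y → ¬ (x ≡ A × y ≡ B) → ¬ (x ≡ B × y ≡ A) →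
    (toℕ (τ y) <ᵇ toℕ (τ x)) ≡ (toℕ y <ᵇ toℕ x)
  τ-monotone x y not-AB not-BA with case x | case y
  ... | is-A refl | is-A refl = both-irrefl A
  ... | is-B refl | is-B refl = both-irrefl B
  ... | is-A refl | is-B refl = contradiction (refl , refl) not-AB
  ... | is-B refl | is-A refl = contradiction (refl , refl) not-BA
  ... | is-A refl | other y≢A y≢B
    rewrite τ-A | τ-other y≢A y≢B | toℕ-A = <ᵇ-sucʳ (toℕ y) (toℕ a) (y≢A ∘ toℕ-to-A)
  ... | is-B refl | other y≢A y≢B
    rewrite τ-B | τ-other y≢A y≢B | toℕ-A = sym (<ᵇ-sucʳ (toℕ y) (toℕ a) (y≢A ∘ toℕ-to-A))
  ... | other x≢A x≢B | is-A refl
    rewrite τ-A | τ-other x≢A x≢B | toℕ-A = <ᵇ-sucˡ (toℕ x) (toℕ a) (x≢B ∘ FinP.toℕ-injective)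
  ... | other x≢A x≢B | is-B refl
    rewrite τ-B | τ-other x≢A x≢B | toℕ-A = sym (<ᵇ-sucˡ (toℕ x) (toℕ a) (x≢B ∘ FinP.toℕ-injective))
  ... | other x≢A x≢B | other y≢A y≢B rewrite τ-other x≢A x≢B | τ-other y≢A y≢B = refl

inversion : ∀ {n} → Vec (Fin n) n → Fin n → Fin n → Bool
inversion u i j = (toℕ i <ᵇ toℕ j) ∧ (toℕ (lookup u j) <ᵇ toℕ (lookup u i))

inversion-at : ∀ {n} {i j : Fin n} → toℕ i < toℕ j → ∀ u → inversion u i j ≡ (toℕ (lookup u j) <ᵇ toℕ (lookup u i))
inversion-at {i = i} {j} i<j u = cong (_∧ (toℕ (lookup u j) <ᵇ toℕ (lookup u i))) (<⇒<ᵇ-true i<j)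

module Swap {m : ℕ} (a : Fin m) where
  open Adjacent a

  relabel : Vec (Fin (suc m)) (suc m) → Vec (Fin (suc m)) (suc m)
  relabel = Vec.map τ

  lookup-relabel : ∀ w i → lookup (relabel w) i ≡ τ (lookup w i)
  lookup-relabel w i = VecP.lookup-map i τ w

  distinct-relabel : ∀ w → distinctB (toList (relabel w)) ≡ distinctB (toList w)
  distinct-relabel = distinctB-map τ τ-injective

  module _ (w : Vec (Fin (suc m)) (suc m)) (inj : Injective _≡_ _≡_ (lookup w)) (co : coParity w a ≡ true) where

    same-parity : ∀ {i j} → lookup w i ≡ A → lookup w j ≡ B → evenB (toℕ i) ≡ evenB (toℕ j)
    same-parity {i} {j} wi≡A wj≡B = begin
      evenB (toℕ i)                 ≡⟨ cong evenB (sym (posOf-lookup w inj i)) ⟩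
      posParity w (lookup w i)      ≡⟨ cong (posParity w) wi≡A ⟩
      posParity w A                 ≡⟨ xnor-true co ⟩
      posParity w B                 ≡⟨ cong (posParity w) (sym wj≡B) ⟩
      posParity w (lookup w j)      ≡⟨ cong evenB (posOf-lookup w inj j) ⟩
      evenB (toℕ j)                 ∎
      where open ≡-Reasoning

    posParity-τ : ∀ v → posParity w (τ v) ≡ posParity w v
    posParity-τ v with case v
    ... | is-A refl = trans (cong (posParity w) τ-A) (sym (xnor-true co))
    ... | is-B refl = trans (cong (posParity w) τ-B) (xnor-true co)
    ... | other v≢A v≢B = cong (posParity w) (τ-other v≢A v≢B)

    coParity-relabel : ∀ b → coParity (relabel w) b ≡ coParity w b
    coParity-relabel b = cong₂ (λ x y → not (x xor y)) (parity (inject₁ b)) (parity (fsuc b))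
      where
      parity : ∀ v → posParity (relabel w) v ≡ posParity w v
      parity v = trans (cong evenB (posOf-map τ τ-involutive w v)) (posParity-τ v)

    -- Neighbouring positions have different parities, so they never hold both a and a+1.
    neighbours : ∀ k → ¬ (lookup w (inject₁ k) ≡ A × lookup w (fsuc k) ≡ B) × ¬ (lookup w (inject₁ k) ≡ B × lookup w (fsuc k) ≡ A)
    neighbours k = (λ (p , q) → b≢not-b (trans (same-parity p q) flip))
                 , (λ (p , q) → b≢not-b (trans (sym (same-parity q p)) flip))
      where
      flip : evenB (toℕ (fsuc k)) ≡ not (evenB (toℕ (inject₁ k)))
      flip = cong (not ∘ evenB) (sym (FinP.toℕ-inject₁ k))

    Des-relabel : Des (relabel w) ≡ Des w
    Des-relabel = VecP.tabulate-cong λ k →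
      trans (cong₂ (λ x y → toℕ x <ᵇ toℕ y) (lookup-relabel w (fsuc k)) (lookup-relabel w (inject₁ k)))
            (τ-monotone _ _ (proj₁ (neighbours k)) (proj₂ (neighbours k)))

    pA pB : Fin (suc m)
    pA = proj₁ (injective⇒surjective inj A)
    pB = proj₁ (injective⇒surjective inj B)

    w[pA] : lookup w pA ≡ A
    w[pA] = proj₂ (injective⇒surjective inj A)

    w[pB] : lookup w pB ≡ B
    w[pB] = proj₂ (injective⇒surjective inj B)

    w'[pA] : lookup (relabel w) pA ≡ B
    w'[pA] = trans (lookup-relabel w pA) (trans (cong τ w[pA]) τ-A)

    w'[pB] : lookup (relabel w) pB ≡ A
    w'[pB] = trans (lookup-relabel w pB) (trans (cong τ w[pB]) τ-B)

    -- After the swap, positions pA and pB carry i + w(i) of different parities.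
    inCB-relabel : inCB (relabel w) ≡ false
    inCB-relabel = inCB-false (relabel w) pB pA (begin
      evenB (toℕ pA + toℕ (lookup (relabel w) pA))  ≡⟨ cong (λ x → evenB (toℕ pA + toℕ x)) (trans (lookup-relabel w pA) (trans (cong τ w[pA]) τ-A)) ⟩
      evenB (toℕ pA + suc (toℕ a))                  ≡⟨ evenB-+ (toℕ pA) _ ⟩
      not (evenB (toℕ pA)) xor not (evenB (toℕ a))  ≡⟨ sym (BoolP.not-distribʳ-xor (not (evenB (toℕ pA))) (evenB (toℕ a))) ⟩
      not (not (evenB (toℕ pA)) xor evenB (toℕ a))  ≡⟨ cong (λ e → not (not e xor evenB (toℕ a))) (same-parity w[pA] w[pB]) ⟩
      not (not (evenB (toℕ pB)) xor evenB (toℕ a))  ≡⟨ cong not (sym (evenB-+ (toℕ pB) _)) ⟩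
      not (evenB (toℕ pB + toℕ a))                  ≡⟨ cong (λ x → not (evenB (toℕ pB + x))) (sym (trans (cong toℕ w'[pB]) toℕ-A)) ⟩
      not (evenB (toℕ pB + toℕ (lookup (relabel w) pB))) ∎)
      where open ≡-Reasoning

    inversion-relabel : ∀ i j → ¬ (lookup w i ≡ A × lookup w j ≡ B) → ¬ (lookup w i ≡ B × lookup w j ≡ A) →
      (toℕ (lookup (relabel w) j) <ᵇ toℕ (lookup (relabel w) i)) ≡ (toℕ (lookup w j) <ᵇ toℕ (lookup w i))
    inversion-relabel i j not-AB not-BA =
      trans (cong₂ (λ x y → toℕ x <ᵇ toℕ y) (lookup-relabel w j) (lookup-relabel w i)) (τ-monotone _ _ not-AB not-BA)

    -- The pairs counted by L have positions of different parity, so L is unchanged.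
    Lstat-relabel : Lstat (relabel w) ≡ Lstat w
    Lstat-relabel = countPairs-cong _ _ same
      where
      same : ∀ i j → ((toℕ i <ᵇ toℕ j) ∧ (toℕ (lookup (relabel w) j) <ᵇ toℕ (lookup (relabel w) i)) ∧ not (evenB (toℕ i + toℕ j)))
                   ≡ ((toℕ i <ᵇ toℕ j) ∧ (toℕ (lookup w j) <ᵇ toℕ (lookup w i)) ∧ not (evenB (toℕ i + toℕ j)))
      same i j with evenB (toℕ i + toℕ j) in i+j
      ... | true  = trans (cong ((toℕ i <ᵇ toℕ j) ∧_) (BoolP.∧-zeroʳ _)) (cong ((toℕ i <ᵇ toℕ j) ∧_) (sym (BoolP.∧-zeroʳ _)))
      ... | false = cong (λ x → (toℕ i <ᵇ toℕ j) ∧ x ∧ true) (inversion-relabel i j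
              (λ (p , q) → b≢not-b (trans (sym (even-sum (toℕ i) (toℕ j) (same-parity p q))) i+j))
              (λ (p , q) → b≢not-b (trans (sym (even-sum (toℕ i) (toℕ j) (sym (same-parity q p)))) i+j)))

    differs⇒positions : ∀ i j → inversion (relabel w) i j ≢ inversion w i j →
      toℕ i < toℕ j × ((i ≡ pA × j ≡ pB) ⊎ (i ≡ pB × j ≡ pA))
    differs⇒positions i j differ with pair-case (lookup w i) (lookup w j)
    ... | inj₁ (wi≡A , wj≡B) = i<j , inj₁ (inj (trans wi≡A (sym w[pA])) , inj (trans wj≡B (sym w[pB])))
      where i<j = ℕP.<ᵇ⇒< _ _ (Equivalence.from BoolP.T-≡ (∧-differs _ differ))
    ... | inj₂ (inj₁ (wi≡B , wj≡A)) = i<j , inj₂ (inj (trans wi≡B (sym w[pB])) , inj (trans wj≡A (sym w[pA])))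
      where i<j = ℕP.<ᵇ⇒< _ _ (Equivalence.from BoolP.T-≡ (∧-differs _ differ))
    ... | inj₂ (inj₂ (not-AB , not-BA)) =
      contradiction (cong ((toℕ i <ᵇ toℕ j) ∧_) (inversion-relabel i j not-AB not-BA)) differ

    agree-off : ∀ lo hi → toℕ lo < toℕ hi → (lo ≡ pA × hi ≡ pB) ⊎ (lo ≡ pB × hi ≡ pA) →
      ∀ i j → ¬ (i ≡ lo × j ≡ hi) → inversion (relabel w) i j ≡ inversion w i j
    agree-off lo hi lo<hi at i j not-at with inversion (relabel w) i j Bool.≟ inversion w i j
    ... | yes same = same
    ... | no differ with differs⇒positions i j differ | at
    ...   | _   , inj₁ (refl , refl) | inj₁ (refl , refl) = contradiction (refl , refl) not-at
    ...   | _   , inj₂ (refl , refl) | inj₂ (refl , refl) = contradiction (refl , refl) not-at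
    ...   | i<j , inj₁ (refl , refl) | inj₂ (refl , refl) = contradiction i<j (ℕP.<⇒≯ lo<hi)
    ...   | i<j , inj₂ (refl , refl) | inj₁ (refl , refl) = contradiction i<j (ℕP.<⇒≯ lo<hi)

    -- Exactly one inversion is created or destroyed, so the sign of w flips.
    ell-relabel : evenB (ell (relabel w)) ≡ not (evenB (ell w))
    ell-relabel with ℕP.<-cmp (toℕ pA) (toℕ pB)
    ... | tri≈ _ pA≡pB _ = contradiction (trans (sym w[pA]) (trans (cong (lookup w) (FinP.toℕ-injective pA≡pB)) w[pB])) A≢B
    ... | tri< pA<pB _ _ = cong evenB (countPairs-bump (inversion (relabel w)) (inversion w) pA pB
            (agree-off pA pB pA<pB (inj₁ (refl , refl)))
            (trans (inversion-at pA<pB (relabel w)) (trans (cong₂ (λ x y → toℕ x <ᵇ toℕ y) w'[pB] w'[pA]) A<B))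
            (trans (inversion-at pA<pB w) (trans (cong₂ (λ x y → toℕ x <ᵇ toℕ y) w[pB] w[pA]) B≮A)))
    ... | tri> _ _ pB<pA = trans (sym (BoolP.not-involutive _)) (cong (not ∘ evenB) (sym
          (countPairs-bump (inversion w) (inversion (relabel w)) pB pA
            (λ i j not-at → sym (agree-off pB pA pB<pA (inj₂ (refl , refl)) i j not-at))
            (trans (inversion-at pB<pA w) (trans (cong₂ (λ x y → toℕ x <ᵇ toℕ y) w[pA] w[pB]) A<B))
            (trans (inversion-at pB<pA (relabel w)) (trans (cong₂ (λ x y → toℕ x <ᵇ toℕ y) w'[pA] w'[pB]) B≮A)))))

module Coefficient (m : ℕ) (I J : Subset m) (k : ℕ) where
  Word : Set
  Word = Vec (Fin (suc m)) (suc m)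

  words : List Word
  words = allVecs (suc m) (suc m)

  distinct : Word → Bool
  distinct w = distinctB (toList w)

  inD : Word → Bool
  inD w = subB J (Des w) ∧ subB (Des w) (∁ I)

  weight : Word → ℤ
  weight w = if Lstat w ≡ᵇ k then sgn (ell w) else + 0

  -- w is counted on the left-hand side but not on the right-hand side
  outside : Word → Bool
  outside w = distinct w ∧ (not (inCB w) ∧ inD w)

  pivot : Fin m → Word → Bool
  pivot a w = first (coParity w) a ∧ outside w

  coeff-Sym : coeff (DIJ I J (Sym (suc m))) k ≡ ΣL words (λ w → distinct w ⊙ inD w ⊙ weight w)
  coeff-Sym = trans (ΣL-filter inD (Sym (suc m)) weight) (ΣL-filter distinct words (λ w → inD w ⊙ weight w))

  coeff-C : coeff (DIJ I J (Csub (suc m))) k ≡ ΣL words (λ w → distinct w ⊙ inCB w ⊙ inD w ⊙ weight w)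
  coeff-C = trans (ΣL-filter inD (Csub (suc m)) weight) (trans (ΣL-filter inCB (Sym (suc m)) (λ w → inD w ⊙ weight w))
    (ΣL-filter distinct words (λ w → inCB w ⊙ inD w ⊙ weight w)))

  -- Every word outside C_n has a pivot, so the pivots partition the outside words.
  outside-by-pivot : ∀ w → outside w ⊙ weight w ≡ ∑[ a < m ] (pivot a w ⊙ weight w)
  outside-by-pivot w = sym (begin
    ∑[ a < m ] (pivot a w ⊙ weight w)                        ≡⟨ ℤΣ.sum-cong-≗ (λ a → ⊙-∧ (first (coParity w) a) _ _) ⟩
    ∑[ a < m ] (first (coParity w) a ⊙ outside w ⊙ weight w)  ≡⟨ ∑-first (coParity w) _ ⟩
    anyF (coParity w) ⊙ outside w ⊙ weight w                 ≡⟨ has-pivot ⟩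
    outside w ⊙ weight w                                     ∎)
    where
    open ≡-Reasoning
    has-pivot : anyF (coParity w) ⊙ outside w ⊙ weight w ≡ outside w ⊙ weight w
    has-pivot with anyF (coParity w) in none | distinct w in d
    ... | true  | _     = refl
    ... | false | false = refl
    ... | false | true rewrite noCoParity⇒inC w (distinct⇒injective w d) none = refl

  pivot-reversing : ∀ a w → pivot a w ≡ true →
    pivot a (Swap.relabel a w) ≡ true × weight (Swap.relabel a w) ≡ - weight w
  pivot-reversing a w piv = trans same-pivot piv , flip-weight
    where
    open Swap a
    outs : outside w ≡ true
    outs = BoolP.∧-conicalʳ (first (coParity w) a) (outside w) piv
    d : distinct w ≡ true
    d = BoolP.∧-conicalˡ (distinct w) (not (inCB w) ∧ inD w) outs
    not-C : not (inCB w) ≡ true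
    not-C = BoolP.∧-conicalˡ (not (inCB w)) (inD w) (BoolP.∧-conicalʳ (distinct w) (not (inCB w) ∧ inD w) outs)
    inj : Injective _≡_ _≡_ (lookup w)
    inj = distinct⇒injective w d
    co : coParity w a ≡ true
    co = first⇒ (coParity w) a (BoolP.∧-conicalˡ (first (coParity w) a) (outside w) piv)
    same-pivot : pivot a (relabel w) ≡ pivot a w
    same-pivot = cong₂ _∧_ (first-cong (coParity-relabel w inj co) a)
      (cong₂ _∧_ (distinct-relabel w)
        (cong₂ _∧_ (trans (cong not (inCB-relabel w inj co)) (sym not-C))
                   (cong (λ D → subB J D ∧ subB D (∁ I)) (Des-relabel w inj co))))
    flip-weight : weight (relabel w) ≡ - weight w
    flip-weight rewrite Lstat-relabel w inj co with Lstat w ≡ᵇ k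
    ... | true  = sgn-flip (ell (relabel w)) (ell w) (ell-relabel w inj co)
    ... | false = refl

  outside-sum : ΣL words (λ w → outside w ⊙ weight w) ≡ + 0
  outside-sum = begin
    ΣL words (λ w → outside w ⊙ weight w)                ≡⟨ ΣL-cong words outside-by-pivot ⟩
    ΣL words (λ w → ∑[ a < m ] (pivot a w ⊙ weight w))   ≡⟨ ΣL-∑ words m (λ a w → pivot a w ⊙ weight w) ⟩
    ∑[ a < m ] ΣL words (λ w → pivot a w ⊙ weight w)     ≡⟨ ℤΣ.sum-cong-≗ cancel ⟩
    ∑[ a < m ] (+ 0)                                     ≡⟨ ℤΣ.sum-replicate-zero m ⟩
    + 0                                                  ∎
    where
    open ≡-Reasoning
    cancel : ∀ a → ΣL words (λ w → pivot a w ⊙ weight w) ≡ + 0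
    cancel a = ΣL-allVecs-involution (suc m) (suc m) (Adjacent.π a) (Adjacent.τ-involutive a)
                 (pivot a) weight (pivot-reversing a)

lemma3p1 : (m : ℕ) (I J : Subset m) → I ∩ J ≡ ⊥ →
    (k : ℕ) → coeff (DIJ I J (Sym (suc m))) k ≡ coeff (DIJ I J (Csub (suc m))) k
lemma3p1 m I J _ k = begin
  coeff (DIJ I J (Sym (suc m))) k
    ≡⟨ coeff-Sym ⟩
  ΣL words (λ w → distinct w ⊙ inD w ⊙ weight w)
    ≡⟨ ΣL-cong words (λ w → ⊙-split (distinct w) (inCB w) (inD w) (weight w)) ⟩
  ΣL words (λ w → distinct w ⊙ inCB w ⊙ inD w ⊙ weight w +ℤ outside w ⊙ weight w)
    ≡⟨ ΣL-+ words (λ w → distinct w ⊙ inCB w ⊙ inD w ⊙ weight w) (λ w → outside w ⊙ weight w) ⟩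
  ΣL words (λ w → distinct w ⊙ inCB w ⊙ inD w ⊙ weight w) +ℤ ΣL words (λ w → outside w ⊙ weight w)
    ≡⟨ cong (ΣL words (λ w → distinct w ⊙ inCB w ⊙ inD w ⊙ weight w) +ℤ_) outside-sum ⟩
  ΣL words (λ w → distinct w ⊙ inCB w ⊙ inD w ⊙ weight w) +ℤ + 0
    ≡⟨ ℤP.+-identityʳ _ ⟩
  ΣL words (λ w → distinct w ⊙ inCB w ⊙ inD w ⊙ weight w)
    ≡⟨ sym coeff-C ⟩
  coeff (DIJ I J (Csub (suc m))) k ∎
  where
  open ≡-Reasoning
  open Coefficient m I J k
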